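{- Let $w\ge1$ and $a,b$ be integers with $0\le a,b<w$. Consider the $\texttt{xoshiro+}$ generator with $w$ bits of output and $8w$ bits of state: state $(s_0,\dots,s_7)$ of $w$-bit words, next-state map \[ \begin{aligned} s'_0&=s_0\oplus s_6, & s'_1&=s_0\oplus s_1\oplus s_2, & s'_2&=s_0\oplus s_2, & s'_3&=s_3\oplus s_4,\\ s'_4&=s_1\oplus s_4\oplus s_5, & s'_5&=s_1\oplus s_5, & s'_6&=s_3\oplus s_6\oplus s_7\oplus(s_1\ll a), & s'_7&=\mathrm{rotl}(s_3\oplus s_7,b), \end{aligned} \] and output $s_0+s_2$ (sum scrambler on the first and third words of state). Then this generator is $7$-dimensionally equidistributed.
   Context: A $w$-bit word is an element of $\{0,1\}^w$, identified with an integer in $[0,2^w)$. $\oplus$ is bitwise xor, $x\ll a$ is $x\cdot 2^a\bmod 2^w$, $\mathrm{rotl}(x,b)$ is left rotation by $b$ positions, and $+$ between words is addition in $\mathbf Z/2^w\mathbf Z$. A generator with $kw$ bits of state (here $k=8$), next-state map $T$ and $w$-bit output function $\varphi$ is $d$-dimensionally equidistributed ($d\le k$) if, as $s$ ranges over all nonzero states, every $d$-tuple $(\varphi(s),\varphi(Ts),\dots,\varphi(T^{d-1}s))$ appears exactly $2^{w(k-d)}$ times, except the all-zero $d$-tuple, which appears $2^{w(k-d)}-1$ times. -}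

module Defs where

open import Data.Bool using (Bool; true; false; if_then_else_; _xor_)
import Data.Bool.Properties as BoolP
open import Data.Nat using (ℕ; zero; suc; _+_; _*_; _∸_; _^_; _<ᵇ_)
open import Data.Nat.DivMod using (_%_; _/_)
open import Data.Fin using (Fin; toℕ)
open import Data.Vec using (Vec; []; _∷_; lookup; tabulate; zipWith; replicate)
import Data.Vec.Properties as VecP
open import Data.List using (List; []; _∷_; concatMap; map; length; filter)
open import Data.Product using (_×_)
open import Relation.Binary.PropositionalEquality using (_≡_; _≢_)
open import Relation.Nullary using (¬?)
open import Relation.Nullary.Decidable using (_×-dec_)
open import Relation.Binary using (DecidableEquality)

-- A w-bit word, least significant bit first: bit i has weight 2^i.
Word : ℕ → Set
Word w = Vec Bool w

toℕw : ∀ {w} → Word w → ℕ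
toℕw []       = 0
toℕw (b ∷ bs) = (if b then 1 else 0) + 2 * toℕw bs

fromℕw : ∀ w → ℕ → Word w
fromℕw zero    n = []
fromℕw (suc w) n = (if n % 2 Data.Nat.≡ᵇ 1 then true else false) ∷ fromℕw w (n / 2)

infixl 6 _⊕_
_⊕_ : ∀ {w} → Word w → Word w → Word w
_⊕_ = zipWith _xor_

_⊞_ : ∀ {w} → Word w → Word w → Word w
_⊞_ {w} x y = fromℕw w (toℕw x + toℕw y)

bitAt : ∀ {w} → Word w → ℕ → Bool
bitAt []       _       = false
bitAt (b ∷ bs) zero    = b
bitAt (b ∷ bs) (suc j) = bitAt bs j

_≪_ : ∀ {w} → Word w → ℕ → Word w
x ≪ a = tabulate (λ i → if toℕ i <ᵇ a then false else bitAt x (toℕ i ∸ a))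

rotl : ∀ {w} → Word w → ℕ → Word w
rotl {zero}  x b = x
rotl {suc n} x b = tabulate (λ i → bitAt x ((toℕ i + (suc n ∸ (b % suc n))) % suc n))

zeroWord : ∀ w → Word w
zeroWord w = replicate w false

_≟w_ : ∀ {w} → DecidableEquality (Word w)
_≟w_ = VecP.≡-dec BoolP._≟_

allVecs : ∀ {A : Set} → List A → (k : ℕ) → List (Vec A k)
allVecs xs zero    = [] ∷ []
allVecs xs (suc k) = concatMap (λ x → map (x ∷_) (allVecs xs k)) xs

allWords : ∀ w → List (Word w)
allWords w = allVecs (false ∷ true ∷ []) w

State : ℕ → ℕ → Set
State w k = Vec (Word w) k

allStates : ∀ w k → List (State w k)
allStates w k = allVecs (allWords w) k

_≟s_ : ∀ {w k} → DecidableEquality (State w k)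
_≟s_ = VecP.≡-dec _≟w_

outputs : ∀ {w k} → (State w k → State w k) → (State w k → Word w) →
          (d : ℕ) → State w k → Vec (Word w) d
outputs T φ zero    s = []
outputs T φ (suc d) s = φ s ∷ outputs T φ d (T s)

countTuple : ∀ {w k} → (State w k → State w k) → (State w k → Word w) →
             (d : ℕ) → Vec (Word w) d → ℕ
countTuple {w} {k} T φ d t =
  length (filter (λ s → ¬? (s ≟s replicate k (zeroWord w)) ×-dec (outputs T φ d s ≟s t))
                 (allStates w k))

Equidistributed : ∀ w k → (State w k → State w k) → (State w k → Word w) → ℕ → Set
Equidistributed w k T φ d =
  (t : Vec (Word w) d) →
    (t ≢ replicate d (zeroWord w) → countTuple T φ d t ≡ 2 ^ (w * (k ∸ d)))
  × (t ≡ replicate d (zeroWord w) → countTuple T φ d t + 1 ≡ 2 ^ (w * (k ∸ d)))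

xoshiroT : ∀ {w} → ℕ → ℕ → State w 8 → State w 8
xoshiroT a b (s0 ∷ s1 ∷ s2 ∷ s3 ∷ s4 ∷ s5 ∷ s6 ∷ s7 ∷ []) =
    (s0 ⊕ s6)
  ∷ (s0 ⊕ s1 ⊕ s2)
  ∷ (s0 ⊕ s2)
  ∷ (s3 ⊕ s4)
  ∷ (s1 ⊕ s4 ⊕ s5)
  ∷ (s1 ⊕ s5)
  ∷ (s3 ⊕ s6 ⊕ s7 ⊕ (s1 ≪ a))
  ∷ rotl (s3 ⊕ s7) b
  ∷ []

xoshiroPlus : ∀ {w} → State w 8 → Word w
xoshiroPlus (s0 ∷ s1 ∷ s2 ∷ _) = s0 ⊞ s2

-- The map s ↦ (s₂, first seven outputs from s) is a bijection of the state space fixing 0.  Since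
-- s₂ evolves as s₂′ = s₀ ⊕ s₂, the pairs (s₂, outputs) and (s₂, trace of s₀) determine each other
-- by word addition and subtraction, and s ↦ (s₂, s₀, (Ts)₀, …, (T⁶s)₀) is linear over GF(2) with
-- an explicit inverse.  That inverse is verified by normalising formal xor-sums in which x ≪ a and
-- rotl x b are uninterpreted additive operators.  Through the bijection, the nonzero states with output tuple t
-- correspond to the words v with v ∷ t nonzero, which number 2^w, or 2^w − 1 when t = 0.

module Submission where

open import Defs
open import Data.Bool using (Bool; true; false; if_then_else_; _xor_)
open import Data.Bool.Properties using (xor-assoc; xor-comm; xor-identityˡ; xor-identityʳ; xor-same)
open import Data.Fin as Fin using (Fin; toℕ; #_)
open import Data.List as List using (List; []; _∷_; _++_; _∷ʳ_; length; filter; foldr; concatMap; cartesianProductWith)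
open import Data.List.Properties using (length-map; length-++; filter-all; foldr-++; ≡-dec)
open import Data.List.Membership.Propositional using (_∈_)
open import Data.List.Membership.Propositional.Properties using (∈-map⁺; ∈-map⁻; ∈-filter⁺; ∈-filter⁻; ∈-cartesianProductWith⁺)
open import Data.List.Membership.Propositional.Properties.WithK using (unique∧set⇒bag)
open import Data.List.Relation.Binary.BagAndSetEquality using (_∼[_]_; set; ∼bag⇒↭)
open import Data.List.Relation.Binary.Permutation.Propositional.Properties using (↭-length)
open import Data.List.Relation.Unary.All as All using ([]; _∷_)
open import Data.List.Relation.Unary.AllPairs using ([]; _∷_)
open import Data.List.Relation.Unary.Any using (here; there)
open import Data.List.Relation.Unary.Unique.Propositional using (Unique)
open import Data.List.Relation.Unary.Unique.Propositional.Properties using (filter⁺; map⁺; cartesianProductWith⁺)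
open import Data.Nat using (ℕ; zero; suc; _+_; _*_; _∸_; _^_; _<ᵇ_; _≡ᵇ_; _≤_; _<_; s≤s; z≤n; _%_; _/_)
open import Data.Nat.Properties using (+-monoˡ-<; *-distribˡ-+; *-monoʳ-≤; *-comm; *-assoc; +-identityʳ; +-assoc; +-comm; *-identityʳ; m∸n+n≡m; m+[n∸m]≡n; <⇒≤; m+n∸n≡m; module ≤-Reasoning)
open import Data.Nat.Divisibility using (divides)
open import Data.Nat.DivMod using ([m+kn]%n≡m%n; +-distrib-/-∣ʳ; m<n⇒m/n≡0; m*n/n≡m; m≡m%n+[m/n]*n; m%n<n)
open import Data.Nat.Tactic.RingSolver using (solve-∀)
open import Data.Product using (_×_; _,_; ∃; proj₂)
import Data.Product.Properties as Product
open import Data.Vec using (Vec; []; _∷_; lookup; map; head; iterate; tabulate; zipWith; replicate)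
open import Data.Vec.Properties using (zipWith-assoc; zipWith-comm; zipWith-identityˡ; zipWith-identityʳ; zipWith-inverseʳ; map-id; map-∘; map-cong; lookup-map; lookup-replicate; tabulate-cong; tabulate-∘; tabulate∘lookup; ∷-injective; ∷-injectiveˡ; ∷-injectiveʳ)
open import Data.Vec.Relation.Binary.Pointwise.Inductive using (Pointwise; []; _∷_; Pointwise-≡⇒≡) renaming (map⁺ to Pointwise-map⁺)
open import Function using (_∘_; mk⇔)
open import Relation.Binary using (DecidableEquality)
open import Relation.Binary.PropositionalEquality using (_≡_; _≢_; refl; sym; trans; cong; cong₂; subst; module ≡-Reasoning)
open import Relation.Nullary using (yes; no; does; ¬_; ¬?)
open import Relation.Nullary.Decidable using (_×-dec_)
open import Relation.Unary using (Decidable)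

-- Xor algebra of words

⊕-assoc : ∀ {w} (x y z : Word w) → (x ⊕ y) ⊕ z ≡ x ⊕ (y ⊕ z)
⊕-assoc = zipWith-assoc xor-assoc

⊕-comm : ∀ {w} (x y : Word w) → x ⊕ y ≡ y ⊕ x
⊕-comm = zipWith-comm xor-comm

⊕-identityˡ : ∀ {w} (x : Word w) → zeroWord w ⊕ x ≡ x
⊕-identityˡ = zipWith-identityˡ xor-identityˡ

⊕-identityʳ : ∀ {w} (x : Word w) → x ⊕ zeroWord w ≡ x
⊕-identityʳ = zipWith-identityʳ xor-identityʳ

⊕-self : ∀ {w} (x : Word w) → x ⊕ x ≡ zeroWord w
⊕-self x = trans (cong (x ⊕_) (sym (map-id x))) (zipWith-inverseʳ xor-same x)

⊕-cancelˡ : ∀ {w} (x y : Word w) → x ⊕ (x ⊕ y) ≡ y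
⊕-cancelˡ x y = begin
  x ⊕ (x ⊕ y)   ≡⟨ sym (⊕-assoc x x y) ⟩
  (x ⊕ x) ⊕ y   ≡⟨ cong (_⊕ y) (⊕-self x) ⟩
  zeroWord _ ⊕ y ≡⟨ ⊕-identityˡ y ⟩
  y             ∎
  where open ≡-Reasoning

x⊕[y⊕z]≡y⊕[x⊕z] : ∀ {w} (x y z : Word w) → x ⊕ (y ⊕ z) ≡ y ⊕ (x ⊕ z)
x⊕[y⊕z]≡y⊕[x⊕z] x y z = begin
  x ⊕ (y ⊕ z) ≡⟨ sym (⊕-assoc x y z) ⟩
  (x ⊕ y) ⊕ z ≡⟨ cong (_⊕ z) (⊕-comm x y) ⟩
  (y ⊕ x) ⊕ z ≡⟨ ⊕-assoc y x z ⟩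
  y ⊕ (x ⊕ z) ∎
  where open ≡-Reasoning

⊕≡0⇒≡ : ∀ {w} {x y : Word w} → x ⊕ y ≡ zeroWord w → x ≡ y
⊕≡0⇒≡ {x = x} {y} x⊕y≡0 = begin
  x              ≡⟨ sym (⊕-cancelˡ y x) ⟩
  y ⊕ (y ⊕ x)    ≡⟨ cong (y ⊕_) (⊕-comm y x) ⟩
  y ⊕ (x ⊕ y)    ≡⟨ cong (y ⊕_) x⊕y≡0 ⟩
  y ⊕ zeroWord _ ≡⟨ ⊕-identityʳ y ⟩
  y              ∎
  where open ≡-Reasoning

additive⇒zero : ∀ {w} (f : Word w → Word w) → (∀ x y → f (x ⊕ y) ≡ f x ⊕ f y) →
                f (zeroWord w) ≡ zeroWord w
additive⇒zero {w} f f-⊕ = begin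
  f (zeroWord w)                  ≡⟨ cong f (sym (⊕-identityˡ (zeroWord w))) ⟩
  f (zeroWord w ⊕ zeroWord w)     ≡⟨ f-⊕ (zeroWord w) (zeroWord w) ⟩
  f (zeroWord w) ⊕ f (zeroWord w) ≡⟨ ⊕-self (f (zeroWord w)) ⟩
  zeroWord w                      ∎
  where open ≡-Reasoning

bitAt-⊕ : ∀ {w} (x y : Word w) j → bitAt (x ⊕ y) j ≡ bitAt x j xor bitAt y j
bitAt-⊕ []      []      j       = refl
bitAt-⊕ (_ ∷ _) (_ ∷ _) zero    = refl
bitAt-⊕ (_ ∷ x) (_ ∷ y) (suc j) = bitAt-⊕ x y j

zipWith-tabulate : ∀ {n} (f : Bool → Bool → Bool) (g h : Fin n → Bool) →
                   zipWith f (tabulate g) (tabulate h) ≡ tabulate (λ i → f (g i) (h i))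
zipWith-tabulate {zero}  f g h = refl
zipWith-tabulate {suc n} f g h =
  cong (f (g Fin.zero) (h Fin.zero) ∷_) (zipWith-tabulate f (λ i → g (Fin.suc i)) (λ i → h (Fin.suc i)))

tabulate-bitAt-⊕ : ∀ {w n} (f : Fin n → Bool → Bool) (j : Fin n → ℕ) →
  (∀ i p q → f i (p xor q) ≡ f i p xor f i q) → (x y : Word w) →
  tabulate (λ i → f i (bitAt (x ⊕ y) (j i)))
    ≡ tabulate (λ i → f i (bitAt x (j i))) ⊕ tabulate (λ i → f i (bitAt y (j i)))
tabulate-bitAt-⊕ f j f-xor x y =
  trans (tabulate-cong λ i → trans (cong (f i) (bitAt-⊕ x y (j i))) (f-xor i _ _))
        (sym (zipWith-tabulate _xor_ _ _))

≪-⊕ : ∀ {w} (x y : Word w) a → (x ⊕ y) ≪ a ≡ (x ≪ a) ⊕ (y ≪ a)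
≪-⊕ x y a = tabulate-bitAt-⊕ (λ i p → if toℕ i <ᵇ a then false else p) (λ i → toℕ i ∸ a)
                              (λ i _ _ → masked-xor (toℕ i <ᵇ a)) x y
  where
  masked-xor : ∀ c {p q} → (if c then false else p xor q) ≡ (if c then false else p) xor (if c then false else q)
  masked-xor true  = refl
  masked-xor false = refl

rotl-⊕ : ∀ {w} (x y : Word w) b → rotl (x ⊕ y) b ≡ rotl x b ⊕ rotl y b
rotl-⊕ {zero}  x y b = refl
rotl-⊕ {suc n} x y b =
  tabulate-bitAt-⊕ (λ _ p → p) (λ i → (toℕ i + (suc n ∸ b % suc n)) % suc n) (λ _ _ _ → refl) x y

-- Arithmetic modulo 2 ^ w

bitValue : Bool → ℕ
bitValue b = if b then 1 else 0

readBit : ℕ → Bool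
readBit r = if r ≡ᵇ 1 then true else false

bitValue<2 : ∀ b → bitValue b < 2
bitValue<2 true  = s≤s (s≤s z≤n)
bitValue<2 false = s≤s z≤n

readBit-bitValue : ∀ b → readBit (bitValue b % 2) ≡ b
readBit-bitValue true  = refl
readBit-bitValue false = refl

bitValue-readBit : ∀ r → r < 2 → bitValue (readBit r) ≡ r
bitValue-readBit 0 _ = refl
bitValue-readBit 1 _ = refl
bitValue-readBit (suc (suc _)) (s≤s (s≤s ()))

[m+k*2]/2≡m/2+k : ∀ m k → (m + k * 2) / 2 ≡ m / 2 + k
[m+k*2]/2≡m/2+k m k = trans (+-distrib-/-∣ʳ m (divides k refl)) (cong (m / 2 +_) (m*n/n≡m k 2))

toℕw<2^w : ∀ {w} (x : Word w) → toℕw x < 2 ^ w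
toℕw<2^w []              = s≤s z≤n
toℕw<2^w {suc w} (b ∷ x) = begin-strict
  bitValue b + 2 * toℕw x <⟨ +-monoˡ-< (2 * toℕw x) (bitValue<2 b) ⟩
  2 + 2 * toℕw x          ≡⟨ sym (*-distribˡ-+ 2 1 (toℕw x)) ⟩
  2 * suc (toℕw x)        ≤⟨ *-monoʳ-≤ 2 (toℕw<2^w x) ⟩
  2 * 2 ^ w               ∎
  where open ≤-Reasoning

fromℕw-toℕw : ∀ {w} (x : Word w) → fromℕw w (toℕw x) ≡ x
fromℕw-toℕw []              = refl
fromℕw-toℕw {suc w} (b ∷ x) =
  cong₂ _∷_ (trans (cong readBit (trans (cong (_% 2) n≡) ([m+kn]%n≡m%n (bitValue b) t 2))) (readBit-bitValue b))
            (trans (cong (fromℕw w) n/2≡t) (fromℕw-toℕw x))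
  where
  t = toℕw x
  n≡ : bitValue b + 2 * t ≡ bitValue b + t * 2
  n≡ = cong (bitValue b +_) (*-comm 2 t)
  n/2≡t : (bitValue b + 2 * t) / 2 ≡ t
  n/2≡t = trans (cong (_/ 2) n≡) (trans ([m+k*2]/2≡m/2+k (bitValue b) t) (cong (_+ t) (m<n⇒m/n≡0 (bitValue<2 b))))

fromℕw-+-multiple : ∀ w n k → fromℕw w (n + 2 ^ w * k) ≡ fromℕw w n
fromℕw-+-multiple zero    n k = refl
fromℕw-+-multiple (suc w) n k =
  cong₂ _∷_ (cong readBit (trans (cong (_% 2) n≡) ([m+kn]%n≡m%n n m 2)))
            (trans (cong (fromℕw w) (trans (cong (_/ 2) n≡) ([m+k*2]/2≡m/2+k n m))) (fromℕw-+-multiple w (n / 2) k))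
  where
  m = 2 ^ w * k
  n≡ : n + 2 * 2 ^ w * k ≡ n + m * 2
  n≡ = cong (n +_) (trans (*-assoc 2 (2 ^ w) k) (*-comm 2 m))

toℕw-fromℕw-residue : ∀ w n → ∃ λ q → n ≡ toℕw (fromℕw w n) + 2 ^ w * q
toℕw-fromℕw-residue zero    n = n , sym (+-identityʳ n)
toℕw-fromℕw-residue (suc w) n with toℕw-fromℕw-residue w (n / 2)
... | q , n/2≡ = q , (begin
  n
    ≡⟨ m≡m%n+[m/n]*n n 2 ⟩
  n % 2 + n / 2 * 2
    ≡⟨ cong (λ h → n % 2 + h * 2) n/2≡ ⟩
  n % 2 + (t + 2 ^ w * q) * 2
    ≡⟨ regroup (n % 2) t (2 ^ w) q ⟩
  n % 2 + 2 * t + 2 * 2 ^ w * q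
    ≡⟨ cong (λ r → r + 2 * t + 2 * 2 ^ w * q) (sym (bitValue-readBit (n % 2) (m%n<n n 2))) ⟩
  bitValue (readBit (n % 2)) + 2 * t + 2 * 2 ^ w * q ∎)
  where
  open ≡-Reasoning
  t = toℕw (fromℕw w (n / 2))
  regroup : ∀ r t P q → r + (t + P * q) * 2 ≡ r + 2 * t + 2 * P * q
  regroup = solve-∀

fromℕw-toℕw-+ : ∀ w n m → fromℕw w (toℕw (fromℕw w n) + m) ≡ fromℕw w (n + m)
fromℕw-toℕw-+ w n m with toℕw-fromℕw-residue w n
... | q , n≡ = begin
  fromℕw w (r + m)               ≡⟨ sym (fromℕw-+-multiple w (r + m) q) ⟩
  fromℕw w (r + m + 2 ^ w * q)   ≡⟨ cong (fromℕw w) (+-assoc r m _) ⟩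
  fromℕw w (r + (m + 2 ^ w * q)) ≡⟨ cong (λ h → fromℕw w (r + h)) (+-comm m _) ⟩
  fromℕw w (r + (2 ^ w * q + m)) ≡⟨ cong (fromℕw w) (sym (+-assoc r _ m)) ⟩
  fromℕw w (r + 2 ^ w * q + m)   ≡⟨ cong (λ h → fromℕw w (h + m)) (sym n≡) ⟩
  fromℕw w (n + m)               ∎
  where
  open ≡-Reasoning
  r = toℕw (fromℕw w n)

infixl 6 _⊟_

_⊟_ : ∀ {w} → Word w → Word w → Word w
_⊟_ {w} x y = fromℕw w (toℕw x + (2 ^ w ∸ toℕw y))

fromℕw-+2^w : ∀ w n → fromℕw w (n + 2 ^ w) ≡ fromℕw w n
fromℕw-+2^w w n = trans (cong (λ m → fromℕw w (n + m)) (sym (*-identityʳ (2 ^ w)))) (fromℕw-+-multiple w n 1)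

⊟-⊞ : ∀ {w} (x y : Word w) → (x ⊟ y) ⊞ y ≡ x
⊟-⊞ {w} x y = begin
  fromℕw w (toℕw (fromℕw w (X + (2 ^ w ∸ Y))) + Y)
    ≡⟨ fromℕw-toℕw-+ w (X + (2 ^ w ∸ Y)) Y ⟩
  fromℕw w (X + (2 ^ w ∸ Y) + Y)
    ≡⟨ cong (fromℕw w) (+-assoc X _ Y) ⟩
  fromℕw w (X + (2 ^ w ∸ Y + Y))
    ≡⟨ cong (λ m → fromℕw w (X + m)) (m∸n+n≡m (<⇒≤ (toℕw<2^w y))) ⟩
  fromℕw w (X + 2 ^ w)
    ≡⟨ fromℕw-+2^w w X ⟩
  fromℕw w X
    ≡⟨ fromℕw-toℕw x ⟩
  x ∎
  where
  open ≡-Reasoning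
  X = toℕw x
  Y = toℕw y

⊞-⊟ : ∀ {w} (x y : Word w) → (x ⊞ y) ⊟ y ≡ x
⊞-⊟ {w} x y = begin
  fromℕw w (toℕw (fromℕw w (X + Y)) + (2 ^ w ∸ Y))
    ≡⟨ fromℕw-toℕw-+ w (X + Y) (2 ^ w ∸ Y) ⟩
  fromℕw w (X + Y + (2 ^ w ∸ Y))
    ≡⟨ cong (fromℕw w) (+-assoc X Y _) ⟩
  fromℕw w (X + (Y + (2 ^ w ∸ Y)))
    ≡⟨ cong (λ m → fromℕw w (X + m)) (m+[n∸m]≡n (<⇒≤ (toℕw<2^w y))) ⟩
  fromℕw w (X + 2 ^ w)
    ≡⟨ fromℕw-+2^w w X ⟩
  fromℕw w X
    ≡⟨ fromℕw-toℕw x ⟩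
  x ∎
  where
  open ≡-Reasoning
  X = toℕw x
  Y = toℕw y

toℕw-zero : ∀ w → toℕw (zeroWord w) ≡ 0
toℕw-zero zero    = refl
toℕw-zero (suc w) = cong (2 *_) (toℕw-zero w)

⊞-identityʳ : ∀ {w} (x : Word w) → x ⊞ zeroWord w ≡ x
⊞-identityʳ {w} x = begin
  fromℕw w (toℕw x + toℕw (zeroWord w)) ≡⟨ cong (λ m → fromℕw w (toℕw x + m)) (toℕw-zero w) ⟩
  fromℕw w (toℕw x + 0)                 ≡⟨ cong (fromℕw w) (+-identityʳ (toℕw x)) ⟩
  fromℕw w (toℕw x)                     ≡⟨ fromℕw-toℕw x ⟩
  x                                     ∎
  where open ≡-Reasoning

-- Enumerations of words and states

cartesianProductWith-concatMap : ∀ {A B C : Set} (f : A → B → C) xs ys →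
  concatMap (λ x → List.map (f x) ys) xs ≡ cartesianProductWith f xs ys
cartesianProductWith-concatMap f []       ys = refl
cartesianProductWith-concatMap f (x ∷ xs) ys = cong (List.map (f x) ys ++_) (cartesianProductWith-concatMap f xs ys)

length-cartesianProductWith : ∀ {A B C : Set} (f : A → B → C) xs ys →
  length (cartesianProductWith f xs ys) ≡ length xs * length ys
length-cartesianProductWith f []       ys = refl
length-cartesianProductWith f (x ∷ xs) ys =
  trans (length-++ (List.map (f x) ys)) (cong₂ _+_ (length-map (f x) ys) (length-cartesianProductWith f xs ys))

module _ {A : Set} {xs : List A} where

  allVecs-suc : ∀ k → allVecs xs (suc k) ≡ cartesianProductWith _∷_ xs (allVecs xs k)
  allVecs-suc k = cartesianProductWith-concatMap _∷_ xs (allVecs xs k)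

  allVecs-unique : Unique xs → ∀ k → Unique (allVecs xs k)
  allVecs-unique xs! zero    = [] ∷ []
  allVecs-unique xs! (suc k) rewrite allVecs-suc k =
    cartesianProductWith⁺ _∷_ ∷-injective xs! (allVecs-unique xs! k)

  ∈-allVecs : (∀ x → x ∈ xs) → ∀ {k} (v : Vec A k) → v ∈ allVecs xs k
  ∈-allVecs ∈xs []            = here refl
  ∈-allVecs ∈xs {suc k} (x ∷ v) rewrite allVecs-suc k =
    ∈-cartesianProductWith⁺ _∷_ (∈xs x) (∈-allVecs ∈xs v)

  length-allVecs : ∀ k → length (allVecs xs k) ≡ length xs ^ k
  length-allVecs zero    = refl
  length-allVecs (suc k) rewrite allVecs-suc k =
    trans (length-cartesianProductWith _∷_ xs (allVecs xs k)) (cong (length xs *_) (length-allVecs k))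

allWords-unique : ∀ w → Unique (allWords w)
allWords-unique = allVecs-unique (((λ ()) ∷ []) ∷ [] ∷ [])

∈-allWords : ∀ {w} (x : Word w) → x ∈ allWords w
∈-allWords = ∈-allVecs λ where
  false → here refl
  true  → there (here refl)

length-allWords : ∀ w → length (allWords w) ≡ 2 ^ w
length-allWords = length-allVecs

allStates-unique : ∀ w k → Unique (allStates w k)
allStates-unique w = allVecs-unique (allWords-unique w)

∈-allStates : ∀ {w k} (s : State w k) → s ∈ allStates w k
∈-allStates = ∈-allVecs ∈-allWords

unique-same-members⇒same-length : ∀ {A : Set} {xs ys : List A} →
  Unique xs → Unique ys → xs ∼[ set ] ys → length xs ≡ length ys
unique-same-members⇒same-length xs! ys! xs∼ys = ↭-length (∼bag⇒↭ (unique∧set⇒bag xs! ys! xs∼ys))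

-- Equidistribution from a bijection

zeroState : ∀ w k → State w k
zeroState w k = replicate k (zeroWord w)

module _ {w d : ℕ} where

  extends? : (t : Vec (Word w) d) → Decidable (λ v → ¬ (v ∷ t) ≡ zeroState w (suc d))
  extends? t v = ¬? ((v ∷ t) ≟s zeroState w (suc d))

  nonzeroExtensions : Vec (Word w) d → List (Word w)
  nonzeroExtensions t = filter (extends? t) (allWords w)

  nonzeroExtensions-unique : ∀ t → Unique (nonzeroExtensions t)
  nonzeroExtensions-unique t = filter⁺ (extends? t) (allWords-unique w)

  ∈-nonzeroExtensions⁻ : ∀ {t v} → v ∈ nonzeroExtensions t → (v ∷ t) ≢ zeroState w (suc d)
  ∈-nonzeroExtensions⁻ {t} v∈ = proj₂ (∈-filter⁻ (extends? t) {xs = allWords w} v∈)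

  length-nonzeroExtensions-≢zero : ∀ {t} → t ≢ zeroState w d → length (nonzeroExtensions t) ≡ 2 ^ w
  length-nonzeroExtensions-≢zero {t} t≢0 = begin
    length (filter (extends? t) (allWords w))
      ≡⟨ cong length (filter-all (extends? t) {xs = allWords w} (All.tabulate λ _ eq → t≢0 (∷-injectiveʳ eq))) ⟩
    length (allWords w)
      ≡⟨ length-allWords w ⟩
    2 ^ w ∎
    where open ≡-Reasoning

  length-nonzeroExtensions-zero : length (nonzeroExtensions (zeroState w d)) + 1 ≡ 2 ^ w
  length-nonzeroExtensions-zero = begin
    length (nonzeroExtensions 𝟘) + 1
      ≡⟨ +-comm _ 1 ⟩
    length (zeroWord w ∷ nonzeroExtensions 𝟘)
      ≡⟨ unique-same-members⇒same-length unique (allWords-unique w) (mk⇔ (λ _ → ∈-allWords _) from) ⟩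
    length (allWords w)
      ≡⟨ length-allWords w ⟩
    2 ^ w ∎
    where
    open ≡-Reasoning
    𝟘 = zeroState w d
    unique : Unique (zeroWord w ∷ nonzeroExtensions 𝟘)
    unique = All.tabulate (λ v∈ 0≡v → ∈-nonzeroExtensions⁻ v∈ (cong (_∷ 𝟘) (sym 0≡v))) ∷ nonzeroExtensions-unique 𝟘
    from : ∀ {v} → v ∈ allWords w → v ∈ zeroWord w ∷ nonzeroExtensions 𝟘
    from {v} _ with v ≟w zeroWord w
    ... | yes refl = here refl
    ... | no v≢0   = there (∈-filter⁺ (extends? 𝟘) (∈-allWords v) (λ eq → v≢0 (∷-injectiveˡ eq)))

module _ {w d : ℕ} (T : State w (suc d) → State w (suc d)) (φ : State w (suc d) → Word w)
         (extra : State w (suc d) → Word w) where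

  withOutputs : State w (suc d) → State w (suc d)
  withOutputs s = extra s ∷ outputs T φ d s

  module _ (restore : State w (suc d) → State w (suc d))
           (restore-withOutputs : ∀ s → restore (withOutputs s) ≡ s)
           (withOutputs-restore : ∀ y → withOutputs (restore y) ≡ y)
           (withOutputs-zero : withOutputs (zeroState w (suc d)) ≡ zeroState w (suc d)) where

    private
      𝟘 = zeroState w (suc d)

      restore-zero : restore 𝟘 ≡ 𝟘
      restore-zero = trans (cong restore (sym withOutputs-zero)) (restore-withOutputs 𝟘)

      withOutputs-≢zero : ∀ {s} → s ≢ 𝟘 → withOutputs s ≢ 𝟘
      withOutputs-≢zero {s} s≢0 eq = s≢0 (trans (sym (restore-withOutputs s)) (trans (cong restore eq) restore-zero))

      restore-≢zero : ∀ {y} → y ≢ 𝟘 → restore y ≢ 𝟘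
      restore-≢zero {y} y≢0 eq = y≢0 (trans (sym (withOutputs-restore y)) (trans (cong withOutputs eq) withOutputs-zero))

      inFibre? : (t : Vec (Word w) d) → Decidable (λ s → (¬ s ≡ 𝟘) × (outputs T φ d s ≡ t))
      inFibre? t s = ¬? (s ≟s 𝟘) ×-dec (outputs T φ d s ≟s t)

    -- v ↦ restore (v ∷ t) maps the nonzero extensions of t bijectively onto the fibre of t.
    countTuple≡length-nonzeroExtensions : ∀ t → countTuple T φ d t ≡ length (nonzeroExtensions t)
    countTuple≡length-nonzeroExtensions t =
      trans (unique-same-members⇒same-length (filter⁺ (inFibre? t) (allStates-unique w (suc d)))
                                             (map⁺ restoreWith-injective (nonzeroExtensions-unique t))
                                             (mk⇔ to from))
            (length-map restoreWith (nonzeroExtensions t))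
      where
      restoreWith : Word w → State w (suc d)
      restoreWith v = restore (v ∷ t)
      restoreWith-injective : ∀ {v v′} → restoreWith v ≡ restoreWith v′ → v ≡ v′
      restoreWith-injective eq =
        ∷-injectiveˡ (trans (sym (withOutputs-restore _)) (trans (cong withOutputs eq) (withOutputs-restore _)))
      to : ∀ {s} → s ∈ filter (inFibre? t) (allStates w (suc d)) → s ∈ List.map restoreWith (nonzeroExtensions t)
      to {s} s∈ with ∈-filter⁻ (inFibre? t) {xs = allStates w (suc d)} s∈
      ... | _ , s≢0 , outputs≡t =
        subst (_∈ List.map restoreWith (nonzeroExtensions t))
              (trans (cong (λ os → restore (extra s ∷ os)) (sym outputs≡t)) (restore-withOutputs s))
              (∈-map⁺ restoreWith (∈-filter⁺ (extends? t) (∈-allWords (extra s))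
                                              (λ eq → withOutputs-≢zero s≢0 (trans (cong (extra s ∷_) outputs≡t) eq))))
      from : ∀ {s} → s ∈ List.map restoreWith (nonzeroExtensions t) → s ∈ filter (inFibre? t) (allStates w (suc d))
      from s∈ with ∈-map⁻ restoreWith s∈
      ... | v , v∈ , refl = ∈-filter⁺ (inFibre? t) (∈-allStates _)
        (restore-≢zero (∈-nonzeroExtensions⁻ v∈) , ∷-injectiveʳ (withOutputs-restore (v ∷ t)))

    withOutputs-bijection⇒equidistributed : Equidistributed w (suc d) T φ d
    withOutputs-bijection⇒equidistributed t =
        (λ t≢0 → trans (countTuple≡length-nonzeroExtensions t) (trans (length-nonzeroExtensions-≢zero t≢0) 2^w≡))
      , λ { refl → trans (cong (_+ 1) (countTuple≡length-nonzeroExtensions t)) (trans (length-nonzeroExtensions-zero {w} {d}) 2^w≡) }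
      where
      2^w≡ : 2 ^ w ≡ 2 ^ (w * (suc d ∸ d))
      2^w≡ = cong (2 ^_) (sym (trans (cong (w *_) (m+n∸n≡m 1 d)) (*-identityʳ w)))

-- Formal xor-sums of additive operators applied to variables

module AdditiveExpr {Op : Set} (_≟ᵒ_ : DecidableEquality Op) where

  infixl 6 _⊕ₑ_

  data Expr (n : ℕ) : Set where
    var   : Fin n → Expr n
    𝟎     : Expr n
    _⊕ₑ_  : Expr n → Expr n → Expr n
    op    : Op → Expr n → Expr n

  vars : ∀ n → Vec (Expr n) n
  vars n = tabulate var

  _[_] : ∀ {m n} → Expr n → Vec (Expr m) n → Expr m
  var i    [ E ] = lookup E i
  𝟎        [ E ] = 𝟎
  (e ⊕ₑ f) [ E ] = e [ E ] ⊕ₑ f [ E ]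
  op o e   [ E ] = op o (e [ E ])

  Monomial : ℕ → Set
  Monomial n = Fin n × List Op

  _≟ₘ_ : ∀ {n} → DecidableEquality (Monomial n)
  _≟ₘ_ = Product.≡-dec Fin._≟_ (≡-dec _≟ᵒ_)

  ops : ∀ {n} → List Op → Expr n → Expr n
  ops c e = foldr op e c

  monomial : ∀ {n} → Monomial n → Expr n
  monomial (i , c) = ops c (var i)

  sumOf : ∀ {n} → List (Monomial n) → Expr n
  sumOf []       = 𝟎
  sumOf (m ∷ ms) = monomial m ⊕ₑ sumOf ms

  -- flattenUnder c e acc adds to acc the monomials of e under the operators c (outermost first);
  -- toggle cancels equal monomials in pairs, as x ⊕ x = 0, so e ≋ f says that e ⊕ f cancels completely.
  toggle : ∀ {n} → Monomial n → List (Monomial n) → List (Monomial n)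
  toggle m []        = m ∷ []
  toggle m (m′ ∷ ms) = if does (m ≟ₘ m′) then ms else m′ ∷ toggle m ms

  flattenUnder : ∀ {n} → List Op → Expr n → List (Monomial n) → List (Monomial n)
  flattenUnder c (var i)  acc = toggle (i , c) acc
  flattenUnder c 𝟎        acc = acc
  flattenUnder c (e ⊕ₑ f) acc = flattenUnder c e (flattenUnder c f acc)
  flattenUnder c (op o e) acc = flattenUnder (c ∷ʳ o) e acc

  normalise : ∀ {n} → Expr n → Expr n
  normalise e = sumOf (flattenUnder [] e [])

  _≋_ : ∀ {n} → Expr n → Expr n → Set
  e ≋ f = flattenUnder [] (e ⊕ₑ f) [] ≡ []

  module Semantics {w : ℕ} (⟦_⟧ᵒ : Op → Word w → Word w)
                   (⟦⟧ᵒ-⊕ : ∀ o x y → ⟦ o ⟧ᵒ (x ⊕ y) ≡ ⟦ o ⟧ᵒ x ⊕ ⟦ o ⟧ᵒ y) where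

    ⟦_⟧ : ∀ {n} → Expr n → Vec (Word w) n → Word w
    ⟦ var i  ⟧ ρ = lookup ρ i
    ⟦ 𝟎      ⟧ ρ = zeroWord w
    ⟦ e ⊕ₑ f ⟧ ρ = ⟦ e ⟧ ρ ⊕ ⟦ f ⟧ ρ
    ⟦ op o e ⟧ ρ = ⟦ o ⟧ᵒ (⟦ e ⟧ ρ)

    ⟦_⟧ᵛ : ∀ {m n} → Vec (Expr n) m → Vec (Word w) n → Vec (Word w) m
    ⟦ E ⟧ᵛ ρ = map (λ e → ⟦ e ⟧ ρ) E

    act : List Op → Word w → Word w
    act c x = foldr ⟦_⟧ᵒ x c

    act-⊕ : ∀ c x y → act c (x ⊕ y) ≡ act c x ⊕ act c y
    act-⊕ []      x y = refl
    act-⊕ (o ∷ c) x y = trans (cong ⟦ o ⟧ᵒ (act-⊕ c x y)) (⟦⟧ᵒ-⊕ o _ _)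

    act-∷ʳ : ∀ c o x → act (c ∷ʳ o) x ≡ act c (⟦ o ⟧ᵒ x)
    act-∷ʳ c o x = foldr-++ ⟦_⟧ᵒ x c (o ∷ [])

    ⟦ops⟧ : ∀ {n} c (e : Expr n) ρ → ⟦ ops c e ⟧ ρ ≡ act c (⟦ e ⟧ ρ)
    ⟦ops⟧ []      e ρ = refl
    ⟦ops⟧ (o ∷ c) e ρ = cong ⟦ o ⟧ᵒ (⟦ops⟧ c e ρ)

    toggle-sound : ∀ {n} m (ms : List (Monomial n)) ρ → ⟦ sumOf (toggle m ms) ⟧ ρ ≡ ⟦ sumOf (m ∷ ms) ⟧ ρ
    toggle-sound m []        ρ = refl
    toggle-sound m (m′ ∷ ms) ρ with m ≟ₘ m′
    ... | yes refl = sym (⊕-cancelˡ (⟦ monomial m ⟧ ρ) (⟦ sumOf ms ⟧ ρ))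
    ... | no _     = trans (cong (⟦ monomial m′ ⟧ ρ ⊕_) (toggle-sound m ms ρ))
                           (x⊕[y⊕z]≡y⊕[x⊕z] (⟦ monomial m′ ⟧ ρ) (⟦ monomial m ⟧ ρ) (⟦ sumOf ms ⟧ ρ))

    flattenUnder-sound : ∀ {n} c (e : Expr n) acc ρ →
      ⟦ sumOf (flattenUnder c e acc) ⟧ ρ ≡ act c (⟦ e ⟧ ρ) ⊕ ⟦ sumOf acc ⟧ ρ
    flattenUnder-sound c (var i) acc ρ =
      trans (toggle-sound (i , c) acc ρ) (cong (_⊕ ⟦ sumOf acc ⟧ ρ) (⟦ops⟧ c (var i) ρ))
    flattenUnder-sound c 𝟎 acc ρ =
      sym (trans (cong (_⊕ ⟦ sumOf acc ⟧ ρ) (additive⇒zero (act c) (act-⊕ c))) (⊕-identityˡ _))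
    flattenUnder-sound c (e ⊕ₑ f) acc ρ = begin
      ⟦ sumOf (flattenUnder c e (flattenUnder c f acc)) ⟧ ρ
        ≡⟨ flattenUnder-sound c e _ ρ ⟩
      act c (⟦ e ⟧ ρ) ⊕ ⟦ sumOf (flattenUnder c f acc) ⟧ ρ
        ≡⟨ cong (act c (⟦ e ⟧ ρ) ⊕_) (flattenUnder-sound c f acc ρ) ⟩
      act c (⟦ e ⟧ ρ) ⊕ (act c (⟦ f ⟧ ρ) ⊕ ⟦ sumOf acc ⟧ ρ)
        ≡⟨ sym (⊕-assoc _ _ _) ⟩
      (act c (⟦ e ⟧ ρ) ⊕ act c (⟦ f ⟧ ρ)) ⊕ ⟦ sumOf acc ⟧ ρ
        ≡⟨ cong (_⊕ ⟦ sumOf acc ⟧ ρ) (sym (act-⊕ c _ _)) ⟩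
      act c (⟦ e ⟧ ρ ⊕ ⟦ f ⟧ ρ) ⊕ ⟦ sumOf acc ⟧ ρ ∎
      where open ≡-Reasoning
    flattenUnder-sound c (op o e) acc ρ =
      trans (flattenUnder-sound (c ∷ʳ o) e acc ρ) (cong (_⊕ ⟦ sumOf acc ⟧ ρ) (act-∷ʳ c o (⟦ e ⟧ ρ)))

    normalise-sound : ∀ {n} (e : Expr n) ρ → ⟦ normalise e ⟧ ρ ≡ ⟦ e ⟧ ρ
    normalise-sound e ρ = trans (flattenUnder-sound [] e [] ρ) (⊕-identityʳ (⟦ e ⟧ ρ))

    ≋-sound : ∀ {n} ρ {e f : Expr n} → e ≋ f → ⟦ e ⟧ ρ ≡ ⟦ f ⟧ ρ
    ≋-sound ρ {e} {f} e≋f = ⊕≡0⇒≡ (trans (sym (normalise-sound (e ⊕ₑ f) ρ)) (cong (λ ms → ⟦ sumOf ms ⟧ ρ) e≋f))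

    ≋ᵛ-sound : ∀ {m n} ρ {E F : Vec (Expr n) m} → Pointwise _≋_ E F → ⟦ E ⟧ᵛ ρ ≡ ⟦ F ⟧ᵛ ρ
    ≋ᵛ-sound ρ E≋F = Pointwise-≡⇒≡ (Pointwise-map⁺ (λ {e} {f} → ≋-sound ρ {e} {f}) E≋F)

    ⟦⟧-subst : ∀ {m n} (e : Expr n) (E : Vec (Expr m) n) ρ → ⟦ e [ E ] ⟧ ρ ≡ ⟦ e ⟧ (⟦ E ⟧ᵛ ρ)
    ⟦⟧-subst (var i)  E ρ = sym (lookup-map i (λ e → ⟦ e ⟧ ρ) E)
    ⟦⟧-subst 𝟎        E ρ = refl
    ⟦⟧-subst (e ⊕ₑ f) E ρ = cong₂ _⊕_ (⟦⟧-subst e E ρ) (⟦⟧-subst f E ρ)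
    ⟦⟧-subst (op o e) E ρ = cong ⟦ o ⟧ᵒ (⟦⟧-subst e E ρ)

    ⟦⟧ᵛ-subst : ∀ {k m n} (F : Vec (Expr n) k) (E : Vec (Expr m) n) ρ →
                ⟦ map (_[ E ]) F ⟧ᵛ ρ ≡ ⟦ F ⟧ᵛ (⟦ E ⟧ᵛ ρ)
    ⟦⟧ᵛ-subst F E ρ = trans (sym (map-∘ _ _ F)) (map-cong (λ e → ⟦⟧-subst e E ρ) F)

    ⟦vars⟧ : ∀ {n} (ρ : Vec (Word w) n) → ⟦ vars n ⟧ᵛ ρ ≡ ρ
    ⟦vars⟧ ρ = trans (sym (tabulate-∘ _ var)) (tabulate∘lookup ρ)

    ⟦⟧-zero : ∀ {n} (e : Expr n) → ⟦ e ⟧ (zeroState w n) ≡ zeroWord w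
    ⟦⟧-zero (var i)  = lookup-replicate i (zeroWord w)
    ⟦⟧-zero 𝟎        = refl
    ⟦⟧-zero (e ⊕ₑ f) = trans (cong₂ _⊕_ (⟦⟧-zero e) (⟦⟧-zero f)) (⊕-identityˡ (zeroWord w))
    ⟦⟧-zero (op o e) = trans (cong ⟦ o ⟧ᵒ (⟦⟧-zero e)) (additive⇒zero ⟦ o ⟧ᵒ (⟦⟧ᵒ-⊕ o))

    ⟦⟧ᵛ-zero : ∀ {m n} (E : Vec (Expr n) m) → ⟦ E ⟧ᵛ (zeroState w n) ≡ zeroState w m
    ⟦⟧ᵛ-zero []      = refl
    ⟦⟧ᵛ-zero (e ∷ E) = cong₂ _∷_ (⟦⟧-zero e) (⟦⟧ᵛ-zero E)


-- The xoshiro+ state map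

iterate-natural : ∀ {A B : Set} (h : A → B) {f : B → B} {g : A → A} → (∀ x → f (h x) ≡ h (g x)) →
                  ∀ n x → iterate f (h x) n ≡ map h (iterate g x n)
iterate-natural h                 comm zero    x = refl
iterate-natural h {f = f} {g = g} comm (suc n) x =
  cong (h x ∷_) (trans (cong (λ z → iterate f z n) (comm x)) (iterate-natural h comm n (g x)))

thirdAndHeads : ∀ {A : Set} → (Vec A 8 → Vec A 8) → Vec A 8 → Vec A 8
thirdAndHeads T s = lookup s (# 2) ∷ map head (iterate T s 7)

thirdAndHeads-natural : ∀ {A B : Set} (h : A → B) {f : Vec B 8 → Vec B 8} {g : Vec A 8 → Vec A 8} →
  (∀ s → f (map h s) ≡ map h (g s)) → ∀ s → thirdAndHeads f (map h s) ≡ map h (thirdAndHeads g s)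
thirdAndHeads-natural h {f} {g} comm s = cong₂ _∷_ (lookup-map (# 2) h s) (begin
  map head (iterate f (map h s) 7)          ≡⟨ cong (map head) (iterate-natural (map h) {f} {g} comm 7 s) ⟩
  map head (map (map h) (iterate g s 7))    ≡⟨ sym (map-∘ head (map h) (iterate g s 7)) ⟩
  map (head ∘ map h) (iterate g s 7)        ≡⟨ map-cong head-map (iterate g s 7) ⟩
  map (h ∘ head) (iterate g s 7)            ≡⟨ map-∘ h head (iterate g s 7) ⟩
  map h (map head (iterate g s 7))          ∎)
  where
  open ≡-Reasoning
  head-map : ∀ (v : Vec _ 8) → head (map h v) ≡ h (head v)
  head-map (_ ∷ _) = refl

data XoshiroOp : Set where
  shl rot : XoshiroOp

_≟ₓ_ : DecidableEquality XoshiroOp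
shl ≟ₓ shl = yes refl
shl ≟ₓ rot = no λ ()
rot ≟ₓ shl = no λ ()
rot ≟ₓ rot = yes refl

open AdditiveExpr _≟ₓ_

L R : ∀ {n} → Expr n → Expr n
L = op shl
R = op rot

stepₛ : ∀ {n} → Vec (Expr n) 8 → Vec (Expr n) 8
stepₛ (s0 ∷ s1 ∷ s2 ∷ s3 ∷ s4 ∷ s5 ∷ s6 ∷ s7 ∷ []) =
    (s0 ⊕ₑ s6)
  ∷ (s0 ⊕ₑ s1 ⊕ₑ s2)
  ∷ (s0 ⊕ₑ s2)
  ∷ (s3 ⊕ₑ s4)
  ∷ (s1 ⊕ₑ s4 ⊕ₑ s5)
  ∷ (s1 ⊕ₑ s5)
  ∷ (s3 ⊕ₑ s6 ⊕ₑ s7 ⊕ₑ L s1)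
  ∷ R (s3 ⊕ₑ s7)
  ∷ []

thirdAndHeadsₛ : ∀ {n} → Vec (Expr n) 8 → Vec (Expr n) 8
thirdAndHeadsₛ = thirdAndHeads (map normalise ∘ stepₛ)

-- y stands for s₂ and xₜ for the first word after t steps.
y x₀ x₁ x₂ x₃ x₄ x₅ x₆ : Expr 8
y  = var (# 0)
x₀ = var (# 1)
x₁ = var (# 2)
x₂ = var (# 3)
x₃ = var (# 4)
x₄ = var (# 5)
x₅ = var (# 6)
x₆ = var (# 7)

fromThirdAndHeadsₛ : Vec (Expr 8) 8
fromThirdAndHeadsₛ =
    x₀
  ∷ R x₀ ⊕ₑ R x₁ ⊕ₑ R (L x₁) ⊕ₑ x₂ ⊕ₑ L x₂ ⊕ₑ R (L x₂) ⊕ₑ L x₃ ⊕ₑ R x₄ ⊕ₑ x₅ ⊕ₑ R x₅ ⊕ₑ x₆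
  ∷ y
  ∷ x₀ ⊕ₑ L (R x₀) ⊕ₑ R (L x₀) ⊕ₑ R (L (R x₀))
    ⊕ₑ x₁ ⊕ₑ L x₁ ⊕ₑ L (R x₁) ⊕ₑ L (R (L x₁)) ⊕ₑ R (L (R x₁)) ⊕ₑ R (L (R (L x₁)))
    ⊕ₑ L x₂ ⊕ₑ L (L x₂) ⊕ₑ L (R (L x₂)) ⊕ₑ R (L (L x₂)) ⊕ₑ R (L (R (L x₂)))
    ⊕ₑ L x₃ ⊕ₑ L (L x₃) ⊕ₑ R x₃ ⊕ₑ R (L (L x₃))
    ⊕ₑ x₄ ⊕ₑ L (R x₄) ⊕ₑ R (L (R x₄))
    ⊕ₑ L x₅ ⊕ₑ L (R x₅) ⊕ₑ R x₅ ⊕ₑ R (L x₅) ⊕ₑ R (L (R x₅))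
    ⊕ₑ x₆ ⊕ₑ L x₆ ⊕ₑ R (L x₆)
    ⊕ₑ y ⊕ₑ R (L y)
  ∷ x₀ ⊕ₑ L x₀ ⊕ₑ R x₀ ⊕ₑ R (L x₀) ⊕ₑ L x₁ ⊕ₑ R x₂ ⊕ₑ R (L x₂) ⊕ₑ x₃ ⊕ₑ L x₃ ⊕ₑ R x₃
    ⊕ₑ x₄ ⊕ₑ R x₅ ⊕ₑ x₆ ⊕ₑ y ⊕ₑ L y ⊕ₑ R (L y)
  ∷ x₀ ⊕ₑ R x₀ ⊕ₑ x₁ ⊕ₑ R (L x₁) ⊕ₑ L x₂ ⊕ₑ R x₄ ⊕ₑ x₅ ⊕ₑ y
  ∷ x₀ ⊕ₑ x₁
  ∷ R (L x₀) ⊕ₑ R (L (R x₀))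
    ⊕ₑ x₁ ⊕ₑ L x₁ ⊕ₑ R (L (R x₁)) ⊕ₑ R (L (R (L x₁)))
    ⊕ₑ x₂ ⊕ₑ R (L (L x₂)) ⊕ₑ R (L (R (L x₂)))
    ⊕ₑ L x₃ ⊕ₑ R x₃ ⊕ₑ R (L (L x₃))
    ⊕ₑ x₄ ⊕ₑ R (L (R x₄))
    ⊕ₑ R x₅ ⊕ₑ R (L x₅) ⊕ₑ R (L (R x₅))
    ⊕ₑ x₆ ⊕ₑ R (L x₆)
    ⊕ₑ y ⊕ₑ R (L y)
  ∷ []

thirdAndHeadsₛ-fromThirdAndHeadsₛ : Pointwise _≋_ (thirdAndHeadsₛ fromThirdAndHeadsₛ) (vars 8)
thirdAndHeadsₛ-fromThirdAndHeadsₛ = refl ∷ refl ∷ refl ∷ refl ∷ refl ∷ refl ∷ refl ∷ refl ∷ []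

fromThirdAndHeadsₛ-thirdAndHeadsₛ : Pointwise _≋_ (map (_[ thirdAndHeadsₛ (vars 8) ]) fromThirdAndHeadsₛ) (vars 8)
fromThirdAndHeadsₛ-thirdAndHeadsₛ = refl ∷ refl ∷ refl ∷ refl ∷ refl ∷ refl ∷ refl ∷ refl ∷ []

scramble : ∀ {w k} → Word w → Vec (Word w) k → Vec (Word w) k
scramble y []       = []
scramble y (x ∷ xs) = (x ⊞ y) ∷ scramble (x ⊕ y) xs

unscramble : ∀ {w k} → Word w → Vec (Word w) k → Vec (Word w) k
unscramble y []       = []
unscramble y (o ∷ os) = (o ⊟ y) ∷ unscramble ((o ⊟ y) ⊕ y) os

unscramble-scramble : ∀ {w k} (y : Word w) (xs : Vec (Word w) k) → unscramble y (scramble y xs) ≡ xs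
unscramble-scramble y []       = refl
unscramble-scramble y (x ∷ xs) rewrite ⊞-⊟ x y = cong (x ∷_) (unscramble-scramble (x ⊕ y) xs)

scramble-unscramble : ∀ {w k} (y : Word w) (os : Vec (Word w) k) → scramble y (unscramble y os) ≡ os
scramble-unscramble y []       = refl
scramble-unscramble y (o ∷ os) = cong₂ _∷_ (⊟-⊞ o y) (scramble-unscramble ((o ⊟ y) ⊕ y) os)

scramble-zero : ∀ {w} k → scramble (zeroWord w) (zeroState w k) ≡ zeroState w k
scramble-zero zero    = refl
scramble-zero {w} (suc k) =
  cong₂ _∷_ (⊞-identityʳ _) (trans (cong (λ y → scramble y (zeroState w k)) (⊕-identityˡ (zeroWord w))) (scramble-zero k))

withScramble : ∀ {w k} → Vec (Word w) (suc k) → Vec (Word w) (suc k)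
withScramble (y ∷ xs) = y ∷ scramble y xs

withUnscramble : ∀ {w k} → Vec (Word w) (suc k) → Vec (Word w) (suc k)
withUnscramble (y ∷ os) = y ∷ unscramble y os

withUnscramble-withScramble : ∀ {w k} (z : Vec (Word w) (suc k)) → withUnscramble (withScramble z) ≡ z
withUnscramble-withScramble (y ∷ xs) = cong (y ∷_) (unscramble-scramble y xs)

withScramble-withUnscramble : ∀ {w k} (z : Vec (Word w) (suc k)) → withScramble (withUnscramble z) ≡ z
withScramble-withUnscramble (y ∷ os) = cong (y ∷_) (scramble-unscramble y os)

withScramble-zero : ∀ {w} k → withScramble (zeroState w (suc k)) ≡ zeroState w (suc k)
withScramble-zero {w} k = cong (zeroWord w ∷_) (scramble-zero k)

module Xoshiro (w a b : ℕ) where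

  ⟦_⟧ᵒ : XoshiroOp → Word w → Word w
  ⟦ shl ⟧ᵒ x = x ≪ a
  ⟦ rot ⟧ᵒ x = rotl x b

  ⟦⟧ᵒ-⊕ : ∀ o x y → ⟦ o ⟧ᵒ (x ⊕ y) ≡ ⟦ o ⟧ᵒ x ⊕ ⟦ o ⟧ᵒ y
  ⟦⟧ᵒ-⊕ shl x y = ≪-⊕ x y a
  ⟦⟧ᵒ-⊕ rot x y = rotl-⊕ x y b

  open Semantics ⟦_⟧ᵒ ⟦⟧ᵒ-⊕

  T : State w 8 → State w 8
  T = xoshiroT a b

  third : State w 8 → Word w
  third s = lookup s (# 2)

  -- The eight-entry pattern lets T (⟦ E ⟧ᵛ ρ) unfold to ⟦ stepₛ E ⟧ᵛ ρ.
  T-⟦⟧ᵛ : ∀ {n} (E : Vec (Expr n) 8) ρ → T (⟦ E ⟧ᵛ ρ) ≡ ⟦ map normalise (stepₛ E) ⟧ᵛ ρ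
  T-⟦⟧ᵛ E@(_ ∷ _ ∷ _ ∷ _ ∷ _ ∷ _ ∷ _ ∷ _ ∷ []) ρ = begin
    T (⟦ E ⟧ᵛ ρ)                            ≡⟨⟩
    ⟦ stepₛ E ⟧ᵛ ρ                          ≡⟨ map-cong (λ e → sym (normalise-sound e ρ)) (stepₛ E) ⟩
    map (λ e → ⟦ normalise e ⟧ ρ) (stepₛ E) ≡⟨ map-∘ (λ e → ⟦ e ⟧ ρ) normalise (stepₛ E) ⟩
    ⟦ map normalise (stepₛ E) ⟧ᵛ ρ          ∎
    where open ≡-Reasoning

  thirdAndHeads-⟦⟧ᵛ : ∀ {n} (E : Vec (Expr n) 8) ρ → thirdAndHeads T (⟦ E ⟧ᵛ ρ) ≡ ⟦ thirdAndHeadsₛ E ⟧ᵛ ρ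
  thirdAndHeads-⟦⟧ᵛ E ρ = thirdAndHeads-natural (λ e → ⟦ e ⟧ ρ) {T} {map normalise ∘ stepₛ} (λ E → T-⟦⟧ᵛ E ρ) E

  fromThirdAndHeads : State w 8 → State w 8
  fromThirdAndHeads = ⟦ fromThirdAndHeadsₛ ⟧ᵛ

  thirdAndHeads-fromThirdAndHeads : ∀ ρ → thirdAndHeads T (fromThirdAndHeads ρ) ≡ ρ
  thirdAndHeads-fromThirdAndHeads ρ = begin
    thirdAndHeads T (⟦ fromThirdAndHeadsₛ ⟧ᵛ ρ)
      ≡⟨ thirdAndHeads-⟦⟧ᵛ fromThirdAndHeadsₛ ρ ⟩
    ⟦ thirdAndHeadsₛ fromThirdAndHeadsₛ ⟧ᵛ ρ
      ≡⟨ ≋ᵛ-sound ρ thirdAndHeadsₛ-fromThirdAndHeadsₛ ⟩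
    ⟦ vars 8 ⟧ᵛ ρ
      ≡⟨ ⟦vars⟧ ρ ⟩
    ρ ∎
    where open ≡-Reasoning

  thirdAndHeads-linear : ∀ s → thirdAndHeads T s ≡ ⟦ thirdAndHeadsₛ (vars 8) ⟧ᵛ s
  thirdAndHeads-linear s = trans (cong (thirdAndHeads T) (sym (⟦vars⟧ s))) (thirdAndHeads-⟦⟧ᵛ (vars 8) s)

  fromThirdAndHeads-thirdAndHeads : ∀ s → fromThirdAndHeads (thirdAndHeads T s) ≡ s
  fromThirdAndHeads-thirdAndHeads s = begin
    ⟦ fromThirdAndHeadsₛ ⟧ᵛ (thirdAndHeads T s)
      ≡⟨ cong ⟦ fromThirdAndHeadsₛ ⟧ᵛ (thirdAndHeads-linear s) ⟩
    ⟦ fromThirdAndHeadsₛ ⟧ᵛ (⟦ thirdAndHeadsₛ (vars 8) ⟧ᵛ s)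
      ≡⟨ sym (⟦⟧ᵛ-subst fromThirdAndHeadsₛ (thirdAndHeadsₛ (vars 8)) s) ⟩
    ⟦ map (_[ thirdAndHeadsₛ (vars 8) ]) fromThirdAndHeadsₛ ⟧ᵛ s
      ≡⟨ ≋ᵛ-sound s fromThirdAndHeadsₛ-thirdAndHeadsₛ ⟩
    ⟦ vars 8 ⟧ᵛ s
      ≡⟨ ⟦vars⟧ s ⟩
    s ∎
    where open ≡-Reasoning

  thirdAndHeads-zero : thirdAndHeads T (zeroState w 8) ≡ zeroState w 8
  thirdAndHeads-zero = trans (thirdAndHeads-linear (zeroState w 8)) (⟦⟧ᵛ-zero (thirdAndHeadsₛ (vars 8)))

  outputs-scramble : ∀ k s → outputs T xoshiroPlus k s ≡ scramble (third s) (map head (iterate T s k))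
  outputs-scramble zero    s = refl
  outputs-scramble (suc k) s@(s0 ∷ _ ∷ s2 ∷ _ ∷ _ ∷ _ ∷ _ ∷ _ ∷ []) = cong (s0 ⊞ s2 ∷_) (outputs-scramble k (T s))

  thirdAndOutputs : State w 8 → State w 8
  thirdAndOutputs = withOutputs T xoshiroPlus third

  fromThirdAndOutputs : State w 8 → State w 8
  fromThirdAndOutputs = fromThirdAndHeads ∘ withUnscramble

  thirdAndOutputs-scramble : ∀ s → thirdAndOutputs s ≡ withScramble (thirdAndHeads T s)
  thirdAndOutputs-scramble s = cong (third s ∷_) (outputs-scramble 7 s)

  fromThirdAndOutputs-thirdAndOutputs : ∀ s → fromThirdAndOutputs (thirdAndOutputs s) ≡ s
  fromThirdAndOutputs-thirdAndOutputs s = begin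
    fromThirdAndOutputs (thirdAndOutputs s)
      ≡⟨ cong fromThirdAndOutputs (thirdAndOutputs-scramble s) ⟩
    fromThirdAndHeads (withUnscramble (withScramble (thirdAndHeads T s)))
      ≡⟨ cong fromThirdAndHeads (withUnscramble-withScramble (thirdAndHeads T s)) ⟩
    fromThirdAndHeads (thirdAndHeads T s)
      ≡⟨ fromThirdAndHeads-thirdAndHeads s ⟩
    s ∎
    where open ≡-Reasoning

  thirdAndOutputs-fromThirdAndOutputs : ∀ z → thirdAndOutputs (fromThirdAndOutputs z) ≡ z
  thirdAndOutputs-fromThirdAndOutputs z = begin
    thirdAndOutputs (fromThirdAndOutputs z)
      ≡⟨ thirdAndOutputs-scramble (fromThirdAndOutputs z) ⟩
    withScramble (thirdAndHeads T (fromThirdAndHeads (withUnscramble z)))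
      ≡⟨ cong withScramble (thirdAndHeads-fromThirdAndHeads (withUnscramble z)) ⟩
    withScramble (withUnscramble z)
      ≡⟨ withScramble-withUnscramble z ⟩
    z ∎
    where open ≡-Reasoning

  thirdAndOutputs-zero : thirdAndOutputs (zeroState w 8) ≡ zeroState w 8
  thirdAndOutputs-zero = begin
    thirdAndOutputs (zeroState w 8)
      ≡⟨ thirdAndOutputs-scramble (zeroState w 8) ⟩
    withScramble (thirdAndHeads T (zeroState w 8))
      ≡⟨ cong withScramble thirdAndHeads-zero ⟩
    withScramble (zeroState w 8)
      ≡⟨ withScramble-zero 7 ⟩
    zeroState w 8 ∎
    where open ≡-Reasoning

proposition8p4 : (w a b : ℕ) → 1 ≤ w → a < w → b < w →
    Equidistributed w 8 (xoshiroT a b) xoshiroPlus 7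
proposition8p4 w a b _ _ _ =
  withOutputs-bijection⇒equidistributed (xoshiroT a b) xoshiroPlus third fromThirdAndOutputs
    fromThirdAndOutputs-thirdAndOutputs thirdAndOutputs-fromThirdAndOutputs thirdAndOutputs-zero
  where open Xoshiro w a b
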